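{- Let $x,y$ be nonempty p-strings with $x\equiv y$. For every integer $\delta$ with $0<\delta<\mathrm{period}(y)$, we have $x[\delta:|x|]\not\equiv y[0:|y|-\delta]$.
   Context: Let $\Sigma$ and $\Pi$ be disjoint alphabets; a p-string is a string over $\Sigma\cup\Pi$, indexed from 0, with $w[i:j]=w[i]\cdots w[j-1]$. A permutation $f$ of $\Pi$ acts on p-strings letterwise, fixing letters of $\Sigma$; $x\equiv y$ iff $f(x)=y$ for some permutation $f$ of $\Pi$. For $p\in\mathbb{N}^+$, $p\le|w|$, $p$ is a period of $w$ iff $w[0:|w|-p]\equiv w[p:|w|]$; $\mathrm{period}(w)$ is the smallest period of a nonempty $w$. -}

module Defs where

open import Data.Nat using (ℕ; _∸_; _≤_; _<_)
open import Data.List using (List; length; take; drop; map)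
open import Data.Sum using (_⊎_; inj₁; inj₂)
open import Data.Product using (∃; _×_)
open import Function.Bundles using (_↔_; Inverse)
open import Relation.Binary.PropositionalEquality using (_≡_)

-- Alphabets Σ (constants) and Π (parameters) are disjoint: letters are Σ ⊎ Π.
module _ (Σ Π : Set) where

  Letter : Set
  Letter = Σ ⊎ Π

  PString : Set
  PString = List Letter

actL : {Σ Π : Set} → (Π → Π) → Letter Σ Π → Letter Σ Π
actL f (inj₁ a) = inj₁ a
actL f (inj₂ b) = inj₂ (f b)

act : {Σ Π : Set} → (Π → Π) → PString Σ Π → PString Σ Π
act f = map (actL f)

_≈p_ : {Σ Π : Set} → PString Σ Π → PString Σ Π → Set
_≈p_ {Σ} {Π} x y = ∃ λ (f : Π ↔ Π) → act (Inverse.to f) x ≡ y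

-- w[i:j] = w[i] ⋯ w[j-1]
sub : {Σ Π : Set} → PString Σ Π → ℕ → ℕ → PString Σ Π
sub w i j = take (j ∸ i) (drop i w)

IsPeriod : {Σ Π : Set} → ℕ → PString Σ Π → Set
IsPeriod p w = (0 < p) × (p ≤ length w) × (sub w 0 (length w ∸ p) ≈p sub w p (length w))

IsSmallestPeriod : {Σ Π : Set} → ℕ → PString Σ Π → Set
IsSmallestPeriod p w = IsPeriod p w × (∀ q → IsPeriod q w → p ≤ q)

{-# OPTIONS --safe #-}
module Submission where

-- If x ≡ y and x[δ:|x|] ≡ y[0:|y|−δ], then transporting the first along the
-- renaming of x ≡ y gives y[δ:|y|] ≡ x[δ:|x|] ≡ y[0:|y|−δ]: δ is a period of y,
-- contradicting δ < period(y).

open import Defs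
open import Data.Nat using (ℕ; _∸_; _<_; _≤_)
open import Data.Nat.Properties using (<⇒≤; <⇒≱; ≤-trans)
open import Data.List using (length; []; take; drop)
open import Data.List.Properties using (take-map; drop-map; length-map; map-∘; map-cong; map-id)
open import Data.Sum using (inj₁; inj₂)
open import Data.Product using (_,_)
open import Function using (_∘_)
open import Function.Bundles using (_↔_; Inverse)
open import Function.Construct.Composition using (_↔-∘_)
open import Function.Construct.Symmetry using (↔-sym)
open import Relation.Nullary using (¬_)
open import Relation.Binary.PropositionalEquality

open Inverse using (to; from)

module _ {Σ Π : Set} where

  act-∘ : (f g : Π → Π) (w : PString Σ Π) → act (f ∘ g) w ≡ act f (act g w)
  act-∘ f g w = trans (map-cong actL-∘ w) (map-∘ w)
    where
    actL-∘ : (c : Letter Σ Π) → actL (f ∘ g) c ≡ actL f (actL g c)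
    actL-∘ (inj₁ a) = refl
    actL-∘ (inj₂ b) = refl

  act-from-to : (f : Π ↔ Π) (w : PString Σ Π) → act (from f) (act (to f) w) ≡ w
  act-from-to f w = trans (sym (map-∘ w)) (trans (map-cong actL-from-to w) (map-id w))
    where
    actL-from-to : (c : Letter Σ Π) → actL (from f) (actL (to f) c) ≡ c
    actL-from-to (inj₁ a) = refl
    actL-from-to (inj₂ b) = cong inj₂ (Inverse.strictlyInverseʳ f b)

  sub-act : (f : Π → Π) (w : PString Σ Π) (i j : ℕ) → sub (act f w) i j ≡ act f (sub w i j)
  sub-act f w i j = trans (cong (take (j ∸ i)) (drop-map i w)) (take-map (j ∸ i) (drop i w))

  ≈p-sym : {x y : PString Σ Π} → x ≈p y → y ≈p x
  ≈p-sym {x} (f , refl) = ↔-sym f , act-from-to f x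

  ≈p-trans : {x y z : PString Σ Π} → x ≈p y → y ≈p z → x ≈p z
  ≈p-trans {x} (f , refl) (g , refl) = g ↔-∘ f , act-∘ (to g) (to f) x

  ≈p-length : {x y : PString Σ Π} → x ≈p y → length x ≡ length y
  ≈p-length {x} (f , refl) = sym (length-map (actL (to f)) x)

  ≈p-sub : {x y : PString Σ Π} → x ≈p y → (i j : ℕ) → sub x i j ≈p sub y i j
  ≈p-sub {x} (f , refl) i j = f , sym (sub-act (to f) x i j)

  shift-≈p⇒isPeriod : {x y : PString Σ Π} → x ≈p y → (δ : ℕ) → 0 < δ → δ ≤ length y →
    sub x δ (length x) ≈p sub y 0 (length y ∸ δ) → IsPeriod δ y
  shift-≈p⇒isPeriod {x} {y} x≈y δ 0<δ δ≤|y| shift≈ =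
    0<δ , δ≤|y| , ≈p-trans (≈p-sym shift≈) suffix≈
    where
    suffix≈ : sub x δ (length x) ≈p sub y δ (length y)
    suffix≈ rewrite sym (≈p-length x≈y) = ≈p-sub x≈y δ (length x)

lemma2 : {Σ Π : Set} (x y : PString Σ Π) → x ≢ [] → y ≢ [] → x ≈p y →
    (p : ℕ) → IsSmallestPeriod p y →
    (δ : ℕ) → 0 < δ → δ < p →
    ¬ (sub x δ (length x) ≈p sub y 0 (length y ∸ δ))
lemma2 x y _ _ x≈y p ((_ , p≤|y| , _) , smallest) δ 0<δ δ<p shift≈ =
  <⇒≱ δ<p (smallest δ δ-isPeriod)
  where
  δ-isPeriod : IsPeriod δ y
  δ-isPeriod = shift-≈p⇒isPeriod x≈y δ 0<δ (≤-trans (<⇒≤ δ<p) p≤|y|) shift≈
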